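{- Let $n\ge 1$ and let $V_1,\dots,V_{\lfloor (n+1)/2\rfloor}$ be the peripheral vertex subsets of $\mathcal{Q}(n)$. Then every vertex $v\in V_j$ has degree $d_v=3(n-1)+2(j-1)$, for $j=1,2,\dots,\lfloor (n+1)/2\rfloor$.
   Context: The $n$-Queens' graph $\mathcal{Q}(n)$ has vertex set $[n]^2$ (squares $(i,j)$ of an $n\times n$ chessboard); two distinct vertices $(i,j),(p,q)$ are adjacent iff $i=p$, or $j=q$, or $i+j=p+q$, or $i-j=p-q$. The peripheral vertex subsets: $V_k$ is the set of squares $(i,j)$ with $\min\{i,j,n+1-i,n+1-j\}=k$, for $k=1,\dots,\lfloor (n+1)/2\rfloor$ (i.e. $V_1$ is the outer ring of the board, $V_2$ the outer ring of the remaining board, and so on). -}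

module Defs where

open import Data.Nat using (ℕ; suc; _+_; _∸_; _⊓_)
open import Data.Nat.Properties using (_≟_)
open import Data.Fin using (Fin; toℕ)
open import Data.Product using (_×_; _,_)
open import Data.Sum using (_⊎_)
open import Data.List using (List; length; filter; allFin; cartesianProduct)
open import Relation.Binary.PropositionalEquality using (_≡_)
open import Relation.Nullary using (¬_; Dec; yes; no)
open import Relation.Nullary.Decidable using (_×-dec_; _⊎-dec_; ¬?)

Square : ℕ → Set
Square n = Fin n × Fin n

row col : ∀ {n} → Square n → ℕ
row (i , j) = suc (toℕ i)
col (i , j) = suc (toℕ j)

-- Adjacency in the n-Queens graph Q(n): distinct and same row, column,
-- anti-diagonal (i+j = p+q) or diagonal (i-j = p-q, i.e. i+q = p+j).
Attack : ∀ {n} → Square n → Square n → Set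
Attack u v = (row u ≡ row v) ⊎ (col u ≡ col v) ⊎
             (row u + col u ≡ row v + col v) ⊎ (row u + col v ≡ row v + col u)

Adjacent : ∀ {n} → Square n → Square n → Set
Adjacent u v = ¬ (u ≡ v) × Attack u v

square-≟ : ∀ {n} (u v : Square n) → Dec (u ≡ v)
square-≟ (i , j) (p , q) with i Data.Fin.≟ p | j Data.Fin.≟ q
... | yes _≡_.refl | yes _≡_.refl = yes _≡_.refl
... | no i≢p | _ = no λ { _≡_.refl → i≢p _≡_.refl }
... | yes _ | no j≢q = no λ { _≡_.refl → j≢q _≡_.refl }

adjacent? : ∀ {n} (u v : Square n) → Dec (Adjacent u v)
adjacent? u v = ¬? (square-≟ u v) ×-dec
  ((row u ≟ row v) ⊎-dec ((col u ≟ col v) ⊎-dec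
   ((row u + col u ≟ row v + col v) ⊎-dec (row u + col v ≟ row v + col u))))

squares : (n : ℕ) → List (Square n)
squares n = cartesianProduct (allFin n) (allFin n)

degree : ∀ {n} → Square n → ℕ
degree {n} v = length (filter (adjacent? v) (squares n))

-- ring index k = min{i, j, n+1-i, n+1-j} (1-based); v ∈ V_k iff ring v ≡ k
ring : ∀ {n} → Square n → ℕ
ring {n} v = (row v ⊓ col v) ⊓ ((suc n ∸ row v) ⊓ (suc n ∸ col v))

{-# OPTIONS --safe #-}
module Submission where

-- The four lines through a square meet pairwise only in that square, so its degree is the
-- total length of its row, column, antidiagonal and diagonal, minus 4.  In 0-based
-- coordinates (a, b), with a* = n-1-a and b* = n-1-b, the diagonal through (a, b) has
-- 1 + min(a + b*, a* + b) cells and (reflecting the board in a column) the antidiagonal has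
-- 1 + min(a + b, a* + b*).  Distributing + over min, these two lengths add up to
-- n + 1 + 2 min(a, b, a*, b*) = n - 1 + 2 ring, hence the degree 3(n-1) + 2(ring-1).

open import Defs
open import Data.Bool using (true; false; if_then_else_; not; _∧_)
open import Data.Fin using (Fin; zero; suc; toℕ)
open import Data.Fin.Properties using (toℕ-injective; toℕ<n)
open import Data.List using (List; _∷_; _++_; length; filter; map; tabulate; allFin; cartesianProduct)
open import Data.List.Properties using (length-++; filter-++; map-tabulate)
open import Data.Nat
open import Data.Nat.Properties
open import Algebra.Properties.CommutativeSemigroup +-commutativeSemigroup using (interchange)
open import Data.Nat.Solver using (module +-*-Solver)
open import Data.Product using (_×_; _,_)
open import Data.Sum using (_⊎_; inj₁; inj₂)
open import Function using (_∘_; id; _⇔_; mk⇔)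
open import Function.Properties.Equivalence using () renaming (trans to ⇔-trans)
open import Level using (0ℓ)
open import Relation.Binary.PropositionalEquality
open import Relation.Nullary using (Dec; does; ¬_; ¬?; yes; no; contradiction)
open import Relation.Nullary.Decidable using (_×-dec_; _⊎-dec_; dec-true; dec-false; does-⇔)
open import Relation.Unary using (Pred; Decidable)
open ≡-Reasoning
open +-*-Solver using (solve; _:+_; _:*_; _:=_; con)

-- Defined through does, so that e.g. 𝟙 (suc m ≟ suc n) and 𝟙 (m ≟ n) are definitionally equal.
𝟙 : {P : Set} → Dec P → ℕ
𝟙 d = if does d then 1 else 0

𝟙-yes : {P : Set} (d : Dec P) → P → 𝟙 d ≡ 1
𝟙-yes d p rewrite dec-true d p = refl

𝟙-no : {P : Set} (d : Dec P) → ¬ P → 𝟙 d ≡ 0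
𝟙-no d ¬p rewrite dec-false d ¬p = refl

𝟙-⇔ : {P Q : Set} → P ⇔ Q → (d : Dec P) (e : Dec Q) → 𝟙 d ≡ 𝟙 e
𝟙-⇔ P⇔Q d e = cong (λ b → if b then 1 else 0) (does-⇔ P⇔Q d e)

∑< : ℕ → (ℕ → ℕ) → ℕ
∑< zero    f = 0
∑< (suc n) f = f 0 + ∑< n (f ∘ suc)

syntax ∑< n (λ k → e) = ∑[ k < n ] e

∑-cong : ∀ n {f g : ℕ → ℕ} → (∀ k → k < n → f k ≡ g k) → ∑< n f ≡ ∑< n g
∑-cong zero    f≗g = refl
∑-cong (suc n) f≗g = cong₂ _+_ (f≗g 0 z<s) (∑-cong n (λ k k<n → f≗g (suc k) (s<s k<n)))

∑-const : ∀ n c → ∑[ k < n ] c ≡ n * c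
∑-const zero    c = refl
∑-const (suc n) c = cong (c +_) (∑-const n c)

∑-zero : ∀ n → ∑[ k < n ] 0 ≡ 0
∑-zero n = trans (∑-const n 0) (*-zeroʳ n)

∑-distrib-+ : ∀ n (f g : ℕ → ℕ) → ∑[ k < n ] (f k + g k) ≡ ∑< n f + ∑< n g
∑-distrib-+ zero    f g = refl
∑-distrib-+ (suc n) f g = begin
  f 0 + g 0 + ∑[ k < n ] (f (suc k) + g (suc k))
    ≡⟨ cong (f 0 + g 0 +_) (∑-distrib-+ n (f ∘ suc) (g ∘ suc)) ⟩
  f 0 + g 0 + (∑< n (f ∘ suc) + ∑< n (g ∘ suc))
    ≡⟨ interchange (f 0) (g 0) _ _ ⟩
  ∑< (suc n) f + ∑< (suc n) g
    ∎

∑-*ˡ : ∀ n c (f : ℕ → ℕ) → ∑[ k < n ] (c * f k) ≡ c * ∑< n f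
∑-*ˡ zero    c f = sym (*-zeroʳ c)
∑-*ˡ (suc n) c f = trans (cong (c * f 0 +_) (∑-*ˡ n c (f ∘ suc))) (sym (*-distribˡ-+ c (f 0) _))

∑-last : ∀ n (f : ℕ → ℕ) → ∑< (suc n) f ≡ ∑< n f + f n
∑-last zero    f = +-comm (f 0) 0
∑-last (suc n) f = trans (cong (f 0 +_) (∑-last n (f ∘ suc))) (sym (+-assoc (f 0) _ _))

∑-reverse : ∀ n (f : ℕ → ℕ) → ∑[ k < n ] f (n ∸ suc k) ≡ ∑< n f
∑-reverse zero    f = refl
∑-reverse (suc n) f = begin
  f n + ∑[ k < n ] f (n ∸ suc k)  ≡⟨ cong (f n +_) (∑-reverse n f) ⟩
  f n + ∑< n f                    ≡⟨ +-comm (f n) _ ⟩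
  ∑< n f + f n                    ≡⟨ ∑-last n f ⟨
  ∑< (suc n) f                    ∎

∑-comm : ∀ m n (f : ℕ → ℕ → ℕ) → ∑[ p < m ] ∑[ q < n ] f p q ≡ ∑[ q < n ] ∑[ p < m ] f p q
∑-comm zero    n f = sym (∑-zero n)
∑-comm (suc m) n f = begin
  ∑[ q < n ] f 0 q + ∑[ p < m ] ∑[ q < n ] f (suc p) q
    ≡⟨ cong (∑[ q < n ] f 0 q +_) (∑-comm m n (f ∘ suc)) ⟩
  ∑[ q < n ] f 0 q + ∑[ q < n ] ∑[ p < m ] f (suc p) q
    ≡⟨ ∑-distrib-+ n (f 0) (λ q → ∑[ p < m ] f (suc p) q) ⟨
  ∑[ q < n ] ∑[ p < suc m ] f p q
    ∎

∑-𝟙-≟ : ∀ n t → ∑[ k < n ] 𝟙 (t ≟ k) ≡ 𝟙 (t <? n)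
∑-𝟙-≟ zero    t       = refl
∑-𝟙-≟ (suc n) zero    = cong suc (∑-zero n)
∑-𝟙-≟ (suc n) (suc t) = ∑-𝟙-≟ n t

∑-𝟙-<? : ∀ k d → ∑[ p < k + d ] 𝟙 (p <? k) ≡ k
∑-𝟙-<? zero    d = ∑-zero d
∑-𝟙-<? (suc k) d = cong suc (∑-𝟙-<? k d)

∑-𝟙-≟-< : ∀ {n t} → t < n → ∑[ k < n ] 𝟙 (t ≟ k) ≡ 1
∑-𝟙-≟-< {n} {t} t<n = trans (∑-𝟙-≟ n t) (𝟙-yes (t <? n) t<n)

∑²-distrib-+ : ∀ n (f g : ℕ → ℕ → ℕ) →
  ∑[ p < n ] ∑[ q < n ] (f p q + g p q) ≡ ∑[ p < n ] ∑[ q < n ] f p q + ∑[ p < n ] ∑[ q < n ] g p q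
∑²-distrib-+ n f g =
  trans (∑-cong n λ p _ → ∑-distrib-+ n (f p) (g p)) (∑-distrib-+ n _ _)

∑²-*ˡ : ∀ n c (f : ℕ → ℕ → ℕ) →
  ∑[ p < n ] ∑[ q < n ] (c * f p q) ≡ c * ∑[ p < n ] ∑[ q < n ] f p q
∑²-*ˡ n c f = trans (∑-cong n λ p _ → ∑-*ˡ n c (f p)) (∑-*ˡ n c _)

Diagonal : ℕ → ℕ → ℕ → ℕ
Diagonal n a b = ∑[ p < n ] ∑[ q < n ] 𝟙 (a + q ≟ p + b)

Diagonal-sym : ∀ n a b → Diagonal n a b ≡ Diagonal n b a
Diagonal-sym n a b = trans (∑-comm n n _) (∑-cong n λ q _ → ∑-cong n λ p _ →
  𝟙-⇔ (mk⇔ (flip a q p b) (flip b p q a)) (a + q ≟ p + b) (b + p ≟ q + a))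
  where
  flip : ∀ x y z w → x + y ≡ z + w → w + z ≡ y + x
  flip x y z w e = trans (+-comm w z) (trans (sym e) (+-comm x y))

Diagonal-offset : ∀ k d a → Diagonal (k + d) a (a + d) ≡ k
Diagonal-offset k d a = begin
  ∑[ p < n ] ∑[ q < n ] 𝟙 (a + q ≟ p + (a + d))
    ≡⟨ ∑-cong n (λ p _ → ∑-cong n λ q _ → 𝟙-⇔ (shift p q) (a + q ≟ p + (a + d)) (p + d ≟ q)) ⟩
  ∑[ p < n ] ∑[ q < n ] 𝟙 (p + d ≟ q)
    ≡⟨ ∑-cong n (λ p _ → ∑-𝟙-≟ n (p + d)) ⟩
  ∑[ p < n ] 𝟙 (p + d <? k + d)
    ≡⟨ ∑-cong n (λ p _ → 𝟙-⇔ (mk⇔ (+-cancelʳ-< d p k) (+-monoˡ-< d)) (p + d <? k + d) (p <? k)) ⟩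
  ∑[ p < n ] 𝟙 (p <? k)
    ≡⟨ ∑-𝟙-<? k d ⟩
  k
    ∎
  where
  n = k + d
  rearrange : ∀ p → p + (a + d) ≡ a + (p + d)
  rearrange p = solve 3 (λ p a d → p :+ (a :+ d) := a :+ (p :+ d)) refl p a d
  shift : ∀ p q → a + q ≡ p + (a + d) ⇔ p + d ≡ q
  shift p q = mk⇔ (λ e → sym (+-cancelˡ-≡ a q (p + d) (trans e (rearrange p))))
                  (λ e → trans (cong (a +_) (sym e)) (sym (rearrange p)))

Diagonal-length-≤ : ∀ {m a a* b b*} → a ≤ b → a + a* ≡ m → b + b* ≡ m →
  Diagonal (suc m) a b ≡ suc ((a + b*) ⊓ (a* + b))
Diagonal-length-≤ {a = a} {b* = b*} a≤b ha hb
  with d , refl ← m≤n⇒∃[o]m+o≡n a≤b | refl ← hb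
  with refl ← +-cancelˡ-≡ a _ _ (trans ha (+-assoc a d b*)) = begin
    Diagonal (suc (a + d + b*)) a (a + d)   ≡⟨ cong (λ n → Diagonal n a (a + d)) (suc-shuffle a d b*) ⟩
    Diagonal (suc (a + b*) + d) a (a + d)   ≡⟨ Diagonal-offset (suc (a + b*)) d a ⟩
    suc (a + b*)                            ≡⟨ cong suc (m≤n⇒m⊓n≡m (m≤m+n (a + b*) (d + d))) ⟨
    suc ((a + b*) ⊓ (a + b* + (d + d)))     ≡⟨ cong (λ x → suc ((a + b*) ⊓ x)) (+-shuffle a d b*) ⟩
    suc ((a + b*) ⊓ (d + b* + (a + d)))     ∎
  where
  suc-shuffle : ∀ a d b* → suc (a + d + b*) ≡ suc (a + b*) + d
  suc-shuffle = solve 3 (λ a d b* → con 1 :+ (a :+ d :+ b*) := con 1 :+ (a :+ b*) :+ d) refl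
  +-shuffle : ∀ a d b* → a + b* + (d + d) ≡ d + b* + (a + d)
  +-shuffle = solve 3 (λ a d b* → a :+ b* :+ (d :+ d) := d :+ b* :+ (a :+ d)) refl

Diagonal-length : ∀ {m} a {a*} b {b*} → a + a* ≡ m → b + b* ≡ m →
  Diagonal (suc m) a b ≡ suc ((a + b*) ⊓ (a* + b))
Diagonal-length {m} a {a*} b {b*} ha hb with ≤-total a b
... | inj₁ a≤b = Diagonal-length-≤ a≤b ha hb
... | inj₂ b≤a = begin
  Diagonal (suc m) a b            ≡⟨ Diagonal-sym (suc m) a b ⟩
  Diagonal (suc m) b a            ≡⟨ Diagonal-length-≤ b≤a hb ha ⟩
  suc ((b + a*) ⊓ (b* + a))       ≡⟨ cong suc (⊓-comm (b + a*) (b* + a)) ⟩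
  suc ((b* + a) ⊓ (b + a*))       ≡⟨ cong suc (cong₂ _⊓_ (+-comm b* a) (+-comm b a*)) ⟩
  suc ((a + b*) ⊓ (a* + b))       ∎

QueenLine : ℕ → ℕ → ℕ → ℕ → Set
QueenLine r c r′ c′ = r ≡ r′ ⊎ c ≡ c′ ⊎ r + c ≡ r′ + c′ ⊎ r + c′ ≡ r′ + c

queenLine? : ∀ r c r′ c′ → Dec (QueenLine r c r′ c′)
queenLine? r c r′ c′ =
  (r ≟ r′) ⊎-dec (c ≟ c′) ⊎-dec (r + c ≟ r′ + c′) ⊎-dec (r + c′ ≟ r′ + c)

QueenMove : ℕ → ℕ → ℕ → ℕ → Set
QueenMove r c r′ c′ = ¬ (r ≡ r′ × c ≡ c′) × QueenLine r c r′ c′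

queenMove? : ∀ r c r′ c′ → Dec (QueenMove r c r′ c′)
queenMove? r c r′ c′ = ¬? ((r ≟ r′) ×-dec (c ≟ c′)) ×-dec queenLine? r c r′ c′

-- The four lines through (r, c) pairwise meet only in (r, c), which each of them contains.
𝟙-queenMove : ∀ {r c r′ c′} (d₁ : Dec (r ≡ r′)) (d₂ : Dec (c ≡ c′))
  (d₃ : Dec (r + c ≡ r′ + c′)) (d₄ : Dec (r + c′ ≡ r′ + c)) →
  𝟙 (¬? (d₁ ×-dec d₂) ×-dec (d₁ ⊎-dec d₂ ⊎-dec d₃ ⊎-dec d₄)) + 4 * (𝟙 d₁ * 𝟙 d₂) ≡
  𝟙 d₁ + 𝟙 d₂ + 𝟙 d₃ + 𝟙 d₄
𝟙-queenMove (yes refl) (yes refl) d₃ d₄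
  rewrite 𝟙-yes d₃ refl | 𝟙-yes d₄ refl = refl
𝟙-queenMove {r} {c} {_} {c′} (yes refl) (no c≢c′) d₃ d₄
  rewrite 𝟙-no d₃ (c≢c′ ∘ +-cancelˡ-≡ r c c′)
        | 𝟙-no d₄ (c≢c′ ∘ sym ∘ +-cancelˡ-≡ r c′ c) = refl
𝟙-queenMove {r} {c} {r′} (no r≢r′) (yes refl) d₃ d₄
  rewrite 𝟙-no d₃ (r≢r′ ∘ +-cancelʳ-≡ c r r′)
        | 𝟙-no d₄ (r≢r′ ∘ +-cancelʳ-≡ c r r′) = refl
𝟙-queenMove (no r≢r′) (no _) (yes e₃) (yes e₄) = contradiction (same-row e₃ e₄) r≢r′
  where
  same-row : ∀ {r c r′ c′} → r + c ≡ r′ + c′ → r + c′ ≡ r′ + c → r ≡ r′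
  same-row {r} {c} {r′} {c′} e₃ e₄ =
    *-cancelˡ-≡ r r′ 2 (+-cancelʳ-≡ (c + c′) (2 * r) (2 * r′) (begin
    2 * r + (c + c′)      ≡⟨ double r c c′ ⟩
    (r + c) + (r + c′)    ≡⟨ cong₂ _+_ e₃ e₄ ⟩
    (r′ + c′) + (r′ + c)  ≡⟨ +-comm (r′ + c′) (r′ + c) ⟩
    (r′ + c) + (r′ + c′)  ≡⟨ double r′ c c′ ⟨
    2 * r′ + (c + c′)     ∎))
    where
    double : ∀ r c c′ → 2 * r + (c + c′) ≡ (r + c) + (r + c′)
    double = solve 3 (λ r c c′ → con 2 :* r :+ (c :+ c′) := (r :+ c) :+ (r :+ c′)) refl
𝟙-queenMove (no _) (no _) (yes _) (no _) = refl
𝟙-queenMove (no _) (no _) (no _) (yes _) = refl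
𝟙-queenMove (no _) (no _) (no _) (no _) = refl

square-≡-⇔ : ∀ {n} {u v : Square n} → u ≡ v ⇔ (row u ≡ row v × col u ≡ col v)
square-≡-⇔ {u = i , j} {k , l} = mk⇔ (λ { refl → refl , refl })
  (λ (e₁ , e₂) → cong₂ _,_ (toℕ-injective (suc-injective e₁)) (toℕ-injective (suc-injective e₂)))

𝟙-adjacent : ∀ {n} (u v : Square n) →
  𝟙 (adjacent? u v) ≡ 𝟙 (queenMove? (row u) (col u) (row v) (col v))
𝟙-adjacent u v =
  cong (λ b → if not b ∧ does (queenLine? (row u) (col u) (row v) (col v)) then 1 else 0)
       (does-⇔ square-≡-⇔ (square-≟ u v) ((row u ≟ row v) ×-dec (col u ≟ col v)))

length-filter-∷ : ∀ {A : Set} {P : Pred A 0ℓ} (P? : Decidable P) x (xs : List A) →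
  length (filter P? (x ∷ xs)) ≡ 𝟙 (P? x) + length (filter P? xs)
length-filter-∷ P? x xs with does (P? x)
... | true  = refl
... | false = refl

length-filter-tabulate : ∀ {A : Set} {P : Pred A 0ℓ} (P? : Decidable P) {n}
  (g : Fin n → A) (f : ℕ → ℕ) →
  (∀ i → 𝟙 (P? (g i)) ≡ f (toℕ i)) → length (filter P? (tabulate g)) ≡ ∑< n f
length-filter-tabulate P? {zero}  g f g≗f = refl
length-filter-tabulate P? {suc n} g f g≗f = trans (length-filter-∷ P? (g zero) (tabulate (g ∘ suc)))
  (cong₂ _+_ (g≗f zero) (length-filter-tabulate P? (g ∘ suc) (f ∘ suc) (g≗f ∘ suc)))

length-filter-cartesianProduct : ∀ {A B : Set} {P : Pred (A × B) 0ℓ} (P? : Decidable P) {m}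
  (g : Fin m → A) (ys : List B) (f : ℕ → ℕ) →
  (∀ i → length (filter P? (map (g i ,_) ys)) ≡ f (toℕ i)) →
  length (filter P? (cartesianProduct (tabulate g) ys)) ≡ ∑< m f
length-filter-cartesianProduct P? {zero}  g ys f g≗f = refl
length-filter-cartesianProduct P? {suc m} g ys f g≗f = begin
  length (filter P? (first ++ rest))
    ≡⟨ cong length (filter-++ P? first rest) ⟩
  length (filter P? first ++ filter P? rest)
    ≡⟨ length-++ (filter P? first) ⟩
  length (filter P? first) + length (filter P? rest)
    ≡⟨ cong₂ _+_ (g≗f zero) (length-filter-cartesianProduct P? (g ∘ suc) ys (f ∘ suc) (g≗f ∘ suc)) ⟩
  ∑< (suc m) f
    ∎
  where
  first = map (g zero ,_) ys
  rest = cartesianProduct (tabulate (g ∘ suc)) ys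

degree-∑ : ∀ {n} (i j : Fin n) →
  degree (i , j) ≡ ∑[ p < n ] ∑[ q < n ] 𝟙 (queenMove? (suc (toℕ i)) (suc (toℕ j)) (suc p) (suc q))
degree-∑ {n} i j = length-filter-cartesianProduct (adjacent? (i , j)) id (allFin n) _ λ k →
  trans (cong (length ∘ filter (adjacent? (i , j))) (map-tabulate id (k ,_)))
        (length-filter-tabulate (adjacent? (i , j)) (k ,_) _ λ l → 𝟙-adjacent (i , j) (k , l))

row-length : ∀ {n a} → a < n → ∑[ p < n ] ∑[ q < n ] 𝟙 (a ≟ p) ≡ n
row-length {n} {a} a<n = begin
  ∑[ p < n ] ∑[ q < n ] 𝟙 (a ≟ p)  ≡⟨ ∑-cong n (λ p _ → ∑-const n (𝟙 (a ≟ p))) ⟩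
  ∑[ p < n ] (n * 𝟙 (a ≟ p))       ≡⟨ ∑-*ˡ n n (λ p → 𝟙 (a ≟ p)) ⟩
  n * ∑[ p < n ] 𝟙 (a ≟ p)         ≡⟨ cong (n *_) (∑-𝟙-≟-< a<n) ⟩
  n * 1                            ≡⟨ *-identityʳ n ⟩
  n                                ∎

column-length : ∀ {n b} → b < n → ∑[ p < n ] ∑[ q < n ] 𝟙 (b ≟ q) ≡ n
column-length {n} b<n =
  trans (∑-cong n λ p _ → ∑-𝟙-≟-< b<n) (trans (∑-const n 1) (*-identityʳ n))

centre-count : ∀ {n a b} → a < n → b < n → ∑[ p < n ] ∑[ q < n ] (𝟙 (a ≟ p) * 𝟙 (b ≟ q)) ≡ 1
centre-count {n} {a} {b} a<n b<n = begin
  ∑[ p < n ] ∑[ q < n ] (𝟙 (a ≟ p) * 𝟙 (b ≟ q))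
    ≡⟨ ∑-cong n (λ p _ → ∑-*ˡ n (𝟙 (a ≟ p)) (λ q → 𝟙 (b ≟ q))) ⟩
  ∑[ p < n ] (𝟙 (a ≟ p) * ∑[ q < n ] 𝟙 (b ≟ q))
    ≡⟨ ∑-cong n (λ p _ → cong (𝟙 (a ≟ p) *_) (∑-𝟙-≟-< b<n)) ⟩
  ∑[ p < n ] (𝟙 (a ≟ p) * 1)
    ≡⟨ ∑-cong n (λ p _ → *-identityʳ (𝟙 (a ≟ p))) ⟩
  ∑[ p < n ] 𝟙 (a ≟ p)
    ≡⟨ ∑-𝟙-≟-< a<n ⟩
  1
    ∎

suc+suc-⇔ : ∀ x y z w → suc x + suc y ≡ suc z + suc w ⇔ x + y ≡ z + w
suc+suc-⇔ x y z w = mk⇔ (λ e → suc-injective (suc-injective (trans (sym (ss x y)) (trans e (ss z w)))))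
                        (λ e → trans (ss x y) (trans (cong (λ t → suc (suc t)) e) (sym (ss z w))))
  where
  ss : ∀ x y → suc x + suc y ≡ suc (suc (x + y))
  ss x y = cong suc (+-suc x y)

diagonal-through : ∀ n a b → ∑[ p < n ] ∑[ q < n ] 𝟙 (suc a + suc q ≟ suc p + suc b) ≡ Diagonal n a b
diagonal-through n a b = ∑-cong n λ p _ → ∑-cong n λ q _ →
  𝟙-⇔ (suc+suc-⇔ a q p b) (suc a + suc q ≟ suc p + suc b) (a + q ≟ p + b)

-- Reflecting the board in a column (q ↦ m - q) exchanges antidiagonals and diagonals.
reflect-column : ∀ a b b* p q q* → b + b* ≡ q + q* → a + b ≡ p + q* → a + q ≡ p + b*
reflect-column a b b* p q q* b+b*≡q+q* e = +-cancelʳ-≡ (b + q*) (a + q) (p + b*) (begin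
  a + q + (b + q*)      ≡⟨ solve 4 (λ a b q q* → a :+ q :+ (b :+ q*) := a :+ b :+ (q :+ q*)) refl a b q q* ⟩
  a + b + (q + q*)      ≡⟨ cong₂ _+_ e (sym b+b*≡q+q*) ⟩
  p + q* + (b + b*)     ≡⟨ solve 4 (λ p b b* q* → p :+ q* :+ (b :+ b*) := p :+ b* :+ (b :+ q*)) refl p b b* q* ⟩
  p + b* + (b + q*)     ∎)

antidiagonal-through : ∀ {m} a {b b*} → b + b* ≡ m →
  ∑[ p < suc m ] ∑[ q < suc m ] 𝟙 (suc a + suc b ≟ suc p + suc q) ≡ Diagonal (suc m) a b*
antidiagonal-through {m} a {b} {b*} b+b*≡m = ∑-cong (suc m) λ p _ → begin
  ∑[ q < suc m ] 𝟙 (suc a + suc b ≟ suc p + suc q)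
    ≡⟨ ∑-reverse (suc m) (λ q → 𝟙 (suc a + suc b ≟ suc p + suc q)) ⟨
  ∑[ q < suc m ] 𝟙 (suc a + suc b ≟ suc p + suc (m ∸ q))
    ≡⟨ ∑-cong (suc m) (λ q q≤m → 𝟙-⇔ (reflected p q (s≤s⁻¹ q≤m))
                                     (suc a + suc b ≟ suc p + suc (m ∸ q)) (a + q ≟ p + b*)) ⟩
  ∑[ q < suc m ] 𝟙 (a + q ≟ p + b*)
    ∎
  where
  reflected : ∀ p q → q ≤ m → suc a + suc b ≡ suc p + suc (m ∸ q) ⇔ a + q ≡ p + b*
  reflected p q q≤m = ⇔-trans (suc+suc-⇔ a b p (m ∸ q))
    (mk⇔ (reflect-column a b b* p q (m ∸ q) h) (reflect-column a q (m ∸ q) p b b* (sym h)))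
    where h = trans b+b*≡m (sym (m+[n∸m]≡n q≤m))

degree-lines : ∀ {m} (i j : Fin (suc m)) →
  degree (i , j) + 4 ≡
  suc m + suc m + Diagonal (suc m) (toℕ i) (m ∸ toℕ j) + Diagonal (suc m) (toℕ i) (toℕ j)
degree-lines {m} i j = begin
  degree (i , j) + 4 * 1
    ≡⟨ cong₂ _+_ (degree-∑ i j) (cong (4 *_) (sym (centre-count a<n b<n))) ⟩
  ∑∑ move + 4 * ∑∑ centre
    ≡⟨ cong (∑∑ move +_) (∑²-*ˡ n 4 centre) ⟨
  ∑∑ move + ∑∑ (λ p q → 4 * centre p q)
    ≡⟨ ∑²-distrib-+ n move (λ p q → 4 * centre p q) ⟨
  ∑∑ (λ p q → move p q + 4 * centre p q)
    ≡⟨ ∑-cong n (λ p _ → ∑-cong n λ q _ → 𝟙-queenMove (suc a ≟ suc p) (suc b ≟ suc q)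
                                          (suc a + suc b ≟ suc p + suc q) (suc a + suc q ≟ suc p + suc b)) ⟩
  ∑∑ (λ p q → on-row p q + on-column p q + on-antidiagonal p q + on-diagonal p q)
    ≡⟨ ∑²-distrib-+ n (λ p q → on-row p q + on-column p q + on-antidiagonal p q) on-diagonal ⟩
  ∑∑ (λ p q → on-row p q + on-column p q + on-antidiagonal p q) + ∑∑ on-diagonal
    ≡⟨ cong (_+ ∑∑ on-diagonal) (∑²-distrib-+ n (λ p q → on-row p q + on-column p q) on-antidiagonal) ⟩
  ∑∑ (λ p q → on-row p q + on-column p q) + ∑∑ on-antidiagonal + ∑∑ on-diagonal
    ≡⟨ cong (λ t → t + ∑∑ on-antidiagonal + ∑∑ on-diagonal) (∑²-distrib-+ n on-row on-column) ⟩
  ∑∑ on-row + ∑∑ on-column + ∑∑ on-antidiagonal + ∑∑ on-diagonal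
    ≡⟨ cong₂ _+_ (cong₂ _+_ (cong₂ _+_ (row-length a<n) (column-length b<n))
                             (antidiagonal-through a (m+[n∸m]≡n b≤m)))
                 (diagonal-through n a b) ⟩
  n + n + Diagonal n a (m ∸ b) + Diagonal n a b
    ∎
  where
  n = suc m
  a = toℕ i
  b = toℕ j
  a<n = toℕ<n i
  b<n = toℕ<n j
  b≤m = s≤s⁻¹ b<n
  ∑∑ : (ℕ → ℕ → ℕ) → ℕ
  ∑∑ f = ∑[ p < n ] ∑[ q < n ] f p q
  move centre on-row on-column on-antidiagonal on-diagonal : ℕ → ℕ → ℕ
  move p q = 𝟙 (queenMove? (suc a) (suc b) (suc p) (suc q))
  centre p q = 𝟙 (a ≟ p) * 𝟙 (b ≟ q)
  on-row p q = 𝟙 (a ≟ p)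
  on-column p q = 𝟙 (b ≟ q)
  on-antidiagonal p q = 𝟙 (suc a + suc b ≟ suc p + suc q)
  on-diagonal p q = 𝟙 (suc a + suc q ≟ suc p + suc b)

+-distrib-⊓-⊓ : ∀ w x y z → w ⊓ x + y ⊓ z ≡ ((w + y) ⊓ (w + z)) ⊓ ((x + y) ⊓ (x + z))
+-distrib-⊓-⊓ w x y z =
  trans (+-distribʳ-⊓ (y ⊓ z) w x) (cong₂ _⊓_ (+-distribˡ-⊓ w y z) (+-distribˡ-⊓ x y z))

diagonals-sum : ∀ x x* y y* → y + y* ≡ x + x* →
  (x + y) ⊓ (x* + y*) + (x + y*) ⊓ (x* + y) ≡ x + x* + 2 * ((x ⊓ y) ⊓ (x* ⊓ y*))
diagonals-sum x x* y y* h = begin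
  (x + y) ⊓ (x* + y*) + (x + y*) ⊓ (x* + y)
    ≡⟨ +-distrib-⊓-⊓ (x + y) (x* + y*) (x + y*) (x* + y) ⟩
  ((x + y + (x + y*)) ⊓ (x + y + (x* + y))) ⊓ ((x* + y* + (x + y*)) ⊓ (x* + y* + (x* + y)))
    ≡⟨ cong₂ _⊓_ (cong₂ _⊓_ (trans (twice-x x y y*) (cong (_+ 2 * x) h))
                            (twice-y x x* y))
                 (cong₂ _⊓_ (trans (+-comm (x* + y*) (x + y*)) (twice-y x x* y*))
                            (trans (+-comm (x* + y*) (x* + y)) (trans (twice-x x* y y*) (cong (_+ 2 * x*) h)))) ⟩
  ((s + 2 * x) ⊓ (s + 2 * y)) ⊓ ((s + 2 * y*) ⊓ (s + 2 * x*))
    ≡⟨ cong₂ _⊓_ (affine x y) (affine y* x*) ⟨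
  (s + 2 * (x ⊓ y)) ⊓ (s + 2 * (y* ⊓ x*))
    ≡⟨ affine (x ⊓ y) (y* ⊓ x*) ⟨
  s + 2 * ((x ⊓ y) ⊓ (y* ⊓ x*))
    ≡⟨ cong (λ t → s + 2 * ((x ⊓ y) ⊓ t)) (⊓-comm y* x*) ⟩
  s + 2 * ((x ⊓ y) ⊓ (x* ⊓ y*))
    ∎
  where
  s = x + x*
  affine : ∀ u v → s + 2 * (u ⊓ v) ≡ (s + 2 * u) ⊓ (s + 2 * v)
  affine u v = trans (cong (s +_) (*-distribˡ-⊓ 2 u v)) (+-distribˡ-⊓ s (2 * u) (2 * v))
  twice-x : ∀ x y y* → x + y + (x + y*) ≡ y + y* + 2 * x
  twice-x = solve 3 (λ x y y* → x :+ y :+ (x :+ y*) := y :+ y* :+ con 2 :* x) refl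
  twice-y : ∀ x x* y → x + y + (x* + y) ≡ x + x* + 2 * y
  twice-y = solve 3 (λ x x* y → x :+ y :+ (x* :+ y) := x :+ x* :+ con 2 :* y) refl

ring-coordinates : ∀ {m} (i j : Fin (suc m)) →
  ring (i , j) ≡ suc ((toℕ i ⊓ toℕ j) ⊓ ((m ∸ toℕ i) ⊓ (m ∸ toℕ j)))
ring-coordinates i j = cong₂ (λ x y → suc (toℕ i ⊓ toℕ j) ⊓ (x ⊓ y))
  (+-∸-assoc 1 (s≤s⁻¹ (toℕ<n i))) (+-∸-assoc 1 (s≤s⁻¹ (toℕ<n j)))

theorem1 : (n : ℕ) → 1 ≤ n → (j : ℕ) → 1 ≤ j → j ≤ (n + 1) / 2 →
    (v : Square n) → ring v ≡ j → degree v ≡ 3 * (n ∸ 1) + 2 * (j ∸ 1)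
theorem1 (suc m) _ _ _ _ (i , j) refl = +-cancelʳ-≡ 4 _ _ (begin
  degree (i , j) + 4
    ≡⟨ degree-lines i j ⟩
  suc m + suc m + Diagonal (suc m) a b* + Diagonal (suc m) a b
    ≡⟨ cong₂ (λ x y → suc m + suc m + x + y) (Diagonal-length a b* a+a*≡m (trans (+-comm b* b) b+b*≡m))
                                             (Diagonal-length a b a+a*≡m b+b*≡m) ⟩
  suc m + suc m + suc ((a + b) ⊓ (a* + b*)) + suc ((a + b*) ⊓ (a* + b))
    ≡⟨ collect (diagonals-sum a a* b b* (trans b+b*≡m (sym a+a*≡m))) ⟩
  3 * m + 2 * r + 4
    ≡⟨ cong (λ t → 3 * m + 2 * (t ∸ 1) + 4) (ring-coordinates i j) ⟨
  3 * m + 2 * (ring (i , j) ∸ 1) + 4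
    ∎)
  where
  a = toℕ i
  b = toℕ j
  a* = m ∸ a
  b* = m ∸ b
  r = (a ⊓ b) ⊓ (a* ⊓ b*)
  a+a*≡m = m+[n∸m]≡n (s≤s⁻¹ (toℕ<n i))
  b+b*≡m = m+[n∸m]≡n (s≤s⁻¹ (toℕ<n j))
  collect : ∀ {x y} → x + y ≡ a + a* + 2 * r → suc m + suc m + suc x + suc y ≡ 3 * m + 2 * r + 4
  collect {x} {y} e = begin
    suc m + suc m + suc x + suc y
      ≡⟨ solve 3 (λ m x y → con 1 :+ m :+ (con 1 :+ m) :+ (con 1 :+ x) :+ (con 1 :+ y)
                         := con 2 :* m :+ (x :+ y) :+ con 4) refl m x y ⟩
    2 * m + (x + y) + 4
      ≡⟨ cong (λ t → 2 * m + t + 4) (trans e (cong (_+ 2 * r) a+a*≡m)) ⟩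
    2 * m + (m + 2 * r) + 4
      ≡⟨ solve 2 (λ m r → con 2 :* m :+ (m :+ con 2 :* r) :+ con 4
                       := con 3 :* m :+ con 2 :* r :+ con 4) refl m r ⟩
    3 * m + 2 * r + 4
      ∎
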